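{- Let $r\ge 4$ and $n\in\mathbb{N}$ with $(r-2)\mid n$, and let $v$ be an integer with $r\le v\le n/(2r)+1$. Among all segments $V\subseteq V(K_{r,2,n})$ of length $v$, the maximum number of edges of $K_{r,2,n}$ induced by $V$ is attained by a segment that starts at the first vertex of some clique $K_r$ of $K_{r,2,n}$ or ends at the last vertex of some clique $K_r$ of $K_{r,2,n}$.
   Context: For $r\ge 3$ and $(r-2)\mid n$, $K_{r,2,n}$ is the graph on $\mathbb{Z}_n=\{0,\dots,n-1\}$ whose edge set is the union of the edge sets of the $n/(r-2)$ cliques $K_r$ on the vertex sets $\{i(r-2),i(r-2)+1,\dots,i(r-2)+r-1\}$ (mod $n$), $i\in\{0,\dots,n/(r-2)-1\}$. The first vertex of the $i$-th clique is $i(r-2)$ and its last vertex is $i(r-2)+r-1$ (mod $n$). A segment is a set of consecutive vertices of $\mathbb{Z}_n$ (cyclically); its length is its number of vertices. -}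

module Defs where

open import Data.Nat using (ℕ; zero; suc; _+_; _*_; _∸_; _/_; _%_; _≡ᵇ_)
open import Data.Bool using (Bool; true; false; _∧_; not)
open import Data.Bool.ListAction using (any)
open import Data.List using (List; []; _∷_; upTo; length; filterᵇ; concatMap; map)
open import Data.Product using (_×_; _,_)

-- Division / remainder by d, with the (never used) convention x/0 = 0, x mod 0 = x.
_div_ : ℕ → ℕ → ℕ
a div zero = 0
a div suc k = a / suc k

_mod_ : ℕ → ℕ → ℕ
a mod zero = a
a mod suc k = a % suc k

numCliques : ℕ → ℕ → ℕ
numCliques r n = n div (r ∸ 2)

firstVertex : ℕ → ℕ → ℕ → ℕ
firstVertex r n i = (i * (r ∸ 2)) mod n

lastVertex : ℕ → ℕ → ℕ → ℕ
lastVertex r n i = (i * (r ∸ 2) + (r ∸ 1)) mod n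

inClique : ℕ → ℕ → ℕ → ℕ → Bool
inClique r n i a = any (λ j → ((i * (r ∸ 2) + j) mod n) ≡ᵇ a) (upTo r)

adj : ℕ → ℕ → ℕ → ℕ → Bool
adj r n a b = not (a ≡ᵇ b) ∧ any (λ i → inClique r n i a ∧ inClique r n i b) (upTo (numCliques r n))

pairsBelow : ℕ → List (ℕ × ℕ)
pairsBelow v = concatMap (λ k → map (λ j → (j , k)) (upTo k)) (upTo v)

segEdges : ℕ → ℕ → ℕ → ℕ → ℕ
segEdges r n s v =
  length (filterᵇ (λ { (j , k) → adj r n ((s + j) mod n) ((s + k) mod n) }) (pairsBelow v))

{-# OPTIONS --safe #-}
module Submission where

-- Write d = r − 2. For a gap 0 < G with G + r ≤ n, the vertices a and a + G (mod n) are adjacent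
-- exactly when (a mod d) + G ≤ d + 1. Grouping the edges of a segment by their gap, each gap G
-- contributes the number of points in a window of a d-periodic set whose trace on every period is
-- an initial segment, and such a count is largest for the window starting at 0. So the segment
-- starting at vertex 0, the first vertex of clique 0, is optimal; v ≤ n/(2r) + 1 is what
-- guarantees G + r ≤ n for every gap G < v.

open import Defs
open import Data.Nat using (ℕ; _+_; _*_; _∸_; _≤_; _<_)
open import Data.Nat.Divisibility using (_∣_)
open import Data.Product using (Σ; _×_; ∃)
open import Data.Sum using (_⊎_)
open import Relation.Binary.PropositionalEquality using (_≡_)

open import Data.Bool using (Bool; true; false; T; not; _∧_)
open import Data.Bool.Properties using (T-∧)
open import Data.Empty using (⊥-elim)
open import Data.List using (List; _++_; applyUpTo; upTo; length; filterᵇ; concatMap; map)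
open import Data.List.Properties using (length-++; filter-++)
open import Data.List.Relation.Unary.Any.Properties using (any⁺; any⁻; applyUpTo⁺; applyUpTo⁻)
open import Data.Nat
open import Data.Nat.Properties
open import Algebra.Properties.CommutativeSemigroup +-commutativeSemigroup using (interchange)
open import Data.Nat.DivMod hiding (_div_; _mod_)
open import Data.Nat.Divisibility using (∣⇒≤)
open import Data.Product using (_,_; proj₂)
open import Data.Sum using (inj₁; inj₂)
open import Function using (_∘_; id; _⇔_; mk⇔; Equivalence)
open import Relation.Binary.PropositionalEquality
open import Relation.Nullary using (¬_)
open import Relation.Nullary.Decidable using (T?; yes; no)

𝟙 : Bool → ℕ
𝟙 true  = 1
𝟙 false = 0

sumBelow : ℕ → (ℕ → ℕ) → ℕ
sumBelow zero    f = 0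
sumBelow (suc n) f = f 0 + sumBelow n (λ i → f (suc i))

syntax sumBelow n (λ i → e) = ∑[ i < n ] e

∑-cong : ∀ n {f g : ℕ → ℕ} → (∀ i → i < n → f i ≡ g i) → ∑[ i < n ] f i ≡ ∑[ i < n ] g i
∑-cong zero    f≡g = refl
∑-cong (suc n) f≡g = cong₂ _+_ (f≡g 0 z<s) (∑-cong n (λ i i<n → f≡g (suc i) (s<s i<n)))

∑-mono-≤ : ∀ n {f g : ℕ → ℕ} → (∀ i → i < n → f i ≤ g i) → ∑[ i < n ] f i ≤ ∑[ i < n ] g i
∑-mono-≤ zero    f≤g = z≤n
∑-mono-≤ (suc n) f≤g = +-mono-≤ (f≤g 0 z<s) (∑-mono-≤ n (λ i i<n → f≤g (suc i) (s<s i<n)))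

∑-distrib-+ : ∀ n (f g : ℕ → ℕ) → ∑[ i < n ] (f i + g i) ≡ ∑[ i < n ] f i + ∑[ i < n ] g i
∑-distrib-+ zero    f g = refl
∑-distrib-+ (suc n) f g =
  trans (cong (f 0 + g 0 +_) (∑-distrib-+ n (f ∘ suc) (g ∘ suc))) (interchange (f 0) (g 0) _ _)

∑-split : ∀ m k (f : ℕ → ℕ) → ∑[ i < m + k ] f i ≡ ∑[ i < m ] f i + ∑[ i < k ] f (m + i)
∑-split zero    k f = refl
∑-split (suc m) k f = trans (cong (f 0 +_) (∑-split m k (f ∘ suc))) (sym (+-assoc (f 0) _ _))

∑-≤-extend : ∀ m k (f : ℕ → ℕ) → ∑[ i < m ] f i ≤ ∑[ i < m + k ] f i
∑-≤-extend m k f = subst (∑[ i < m ] f i ≤_) (sym (∑-split m k f)) (m≤m+n _ _)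

∑-last : ∀ n (f : ℕ → ℕ) → ∑[ i < suc n ] f i ≡ ∑[ i < n ] f i + f n
∑-last zero    f = +-identityʳ (f 0)
∑-last (suc n) f = trans (cong (f 0 +_) (∑-last n (f ∘ suc))) (sym (+-assoc (f 0) _ _))

∑-periodic : ∀ d (f : ℕ → ℕ) → (∀ x → f (x + d) ≡ f x) →
             ∀ t → ∑[ j < d ] f (t + j) ≡ ∑[ j < d ] f j
∑-periodic d f periodic zero    = refl
∑-periodic d f periodic (suc t) = trans shift (∑-periodic d f periodic t)
  where
  open ≡-Reasoning
  shift : ∑[ j < d ] f (suc t + j) ≡ ∑[ j < d ] f (t + j)
  shift = +-cancelʳ-≡ (f t) _ _ (begin
    ∑[ j < d ] f (suc t + j) + f t   ≡⟨ +-comm _ (f t) ⟩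
    f t + ∑[ j < d ] f (suc t + j)   ≡⟨ cong₂ _+_ (cong f (sym (+-identityʳ t)))
                                                  (∑-cong d (λ j _ → cong f (sym (+-suc t j)))) ⟩
    ∑[ j < suc d ] f (t + j)         ≡⟨ ∑-last d (λ j → f (t + j)) ⟩
    ∑[ j < d ] f (t + j) + f (t + d) ≡⟨ cong (∑[ j < d ] f (t + j) +_) (periodic t) ⟩
    ∑[ j < d ] f (t + j) + f t       ∎)

∑-triangle-by-gap : ∀ v (F : ℕ → ℕ → ℕ) →
  ∑[ k < v ] ∑[ j < k ] F j (k ∸ j) ≡ ∑[ h < v ] ∑[ j < v ∸ suc h ] F j (suc h)
∑-triangle-by-gap zero    F = refl
∑-triangle-by-gap (suc v) F = begin
  ∑[ k < v ] (F 0 (suc k) + ∑[ j < k ] F (suc j) (k ∸ j))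
    ≡⟨ ∑-distrib-+ v _ _ ⟩
  ∑[ k < v ] F 0 (suc k) + ∑[ k < v ] ∑[ j < k ] F (suc j) (k ∸ j)
    ≡⟨ cong (∑[ k < v ] F 0 (suc k) +_) (∑-triangle-by-gap v (F ∘ suc)) ⟩
  ∑[ h < v ] F 0 (suc h) + ∑[ h < v ] ∑[ j < v ∸ suc h ] F (suc j) (suc h)
    ≡⟨ ∑-distrib-+ v _ _ ⟨
  ∑[ h < v ] ∑[ j < suc (v ∸ suc h) ] F j (suc h)
    ≡⟨ ∑-cong v (λ h h<v → cong (λ m → ∑[ j < m ] F j (suc h)) (+-∸-assoc 1 h<v)) ⟨
  ∑[ h < v ] ∑[ j < v ∸ h ] F j (suc h)
    ≡⟨ +-identityʳ _ ⟨
  ∑[ h < v ] ∑[ j < v ∸ h ] F j (suc h) + ∑[ j < 0 ] F j (suc v)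
    ≡⟨ cong (λ m → ∑[ h < v ] ∑[ j < v ∸ h ] F j (suc h) + ∑[ j < m ] F j (suc v)) (n∸n≡0 v) ⟨
  ∑[ h < v ] ∑[ j < v ∸ h ] F j (suc h) + ∑[ j < v ∸ v ] F j (suc v)
    ≡⟨ ∑-last v (λ h → ∑[ j < v ∸ h ] F j (suc h)) ⟨
  ∑[ h < suc v ] ∑[ j < suc v ∸ suc h ] F j (suc h) ∎
  where open ≡-Reasoning

∑-𝟙-≤ : ∀ n (p : ℕ → Bool) → ∑[ i < n ] 𝟙 (p i) ≤ n
∑-𝟙-≤ zero    p = z≤n
∑-𝟙-≤ (suc n) p = +-mono-≤ (𝟙≤1 (p 0)) (∑-𝟙-≤ n (p ∘ suc))
  where
  𝟙≤1 : ∀ b → 𝟙 b ≤ 1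
  𝟙≤1 true  = ≤-refl
  𝟙≤1 false = z≤n

∑-𝟙-all : ∀ n (p : ℕ → Bool) → (∀ i → i < n → T (p i)) → ∑[ i < n ] 𝟙 (p i) ≡ n
∑-𝟙-all zero    p all = refl
∑-𝟙-all (suc n) p all with p 0 | all 0 z<s
... | true  | _  = cong suc (∑-𝟙-all n (p ∘ suc) (λ i i<n → all (suc i) (s<s i<n)))
... | false | ()

∑-𝟙-none : ∀ n (p : ℕ → Bool) → (∀ i → i < n → ¬ T (p i)) → ∑[ i < n ] 𝟙 (p i) ≡ 0
∑-𝟙-none zero    p none = refl
∑-𝟙-none (suc n) p none with p 0 | none 0 z<s
... | false | _ = ∑-𝟙-none n (p ∘ suc) (λ i i<n → none (suc i) (s<s i<n))
... | true  | ¬T = ⊥-elim (¬T _)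

length-filterᵇ-concatMap-applyUpTo : ∀ {A : Set} (p : A → Bool) (g : ℕ → List A) (f : ℕ → ℕ) n →
  length (filterᵇ p (concatMap g (applyUpTo f n))) ≡ ∑[ i < n ] length (filterᵇ p (g (f i)))
length-filterᵇ-concatMap-applyUpTo p g f zero    = refl
length-filterᵇ-concatMap-applyUpTo p g f (suc n) = begin
  length (filterᵇ p (g (f 0) ++ rest))                  ≡⟨ cong length (filter-++ (T? ∘ p) (g (f 0)) rest) ⟩
  length (filterᵇ p (g (f 0)) ++ filterᵇ p rest)         ≡⟨ length-++ (filterᵇ p (g (f 0))) ⟩
  length (filterᵇ p (g (f 0))) + length (filterᵇ p rest) ≡⟨ cong (_ +_) (length-filterᵇ-concatMap-applyUpTo p g (f ∘ suc) n) ⟩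
  ∑[ i < suc n ] length (filterᵇ p (g (f i)))            ∎
  where
  open ≡-Reasoning
  rest = concatMap g (applyUpTo (f ∘ suc) n)

length-filterᵇ-map-applyUpTo : ∀ {A : Set} (p : A → Bool) (g : ℕ → A) (f : ℕ → ℕ) n →
  length (filterᵇ p (map g (applyUpTo f n))) ≡ ∑[ i < n ] 𝟙 (p (g (f i)))
length-filterᵇ-map-applyUpTo p g f zero = refl
length-filterᵇ-map-applyUpTo p g f (suc n) with p (g (f 0))
... | true  = cong suc (length-filterᵇ-map-applyUpTo p g (f ∘ suc) n)
... | false = length-filterᵇ-map-applyUpTo p g (f ∘ suc) n

length-filterᵇ-pairsBelow : ∀ (P : ℕ × ℕ → Bool) v →
  length (filterᵇ P (pairsBelow v)) ≡ ∑[ k < v ] ∑[ j < k ] 𝟙 (P (j , k))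
length-filterᵇ-pairsBelow P v =
  trans (length-filterᵇ-concatMap-applyUpTo P _ id v)
        (∑-cong v (λ k _ → length-filterᵇ-map-applyUpTo P (_, k) id k))

windowCount : (ℕ → Bool) → ℕ → ℕ → ℕ
windowCount p t L = ∑[ j < L ] 𝟙 (p (t + j))

module PeriodicDownset (d : ℕ) .{{_ : NonZero d}} (p : ℕ → Bool)
  (periodic : ∀ x → p (x + d) ≡ p x)
  (downward : ∀ {x y} → x ≤ y → y < d → T (p y) → T (p x)) where

  windowCount-period : ∀ t → windowCount p t d ≡ windowCount p 0 d
  windowCount-period = ∑-periodic d (𝟙 ∘ p) (cong 𝟙 ∘ periodic)

  windowCount-+period : ∀ t L → windowCount p t (d + L) ≡ windowCount p 0 d + windowCount p t L
  windowCount-+period t L = trans (∑-split d L (λ j → 𝟙 (p (t + j))))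
    (cong₂ _+_ (windowCount-period t) (∑-cong L (λ j _ → cong 𝟙 (shift j))))
    where
    shift : ∀ j → p (t + (d + j)) ≡ p (t + j)
    shift j = trans (cong p (trans (cong (t +_) (+-comm d j)) (sym (+-assoc t j d)))) (periodic (t + j))

  windowCount-short : ∀ t L → L ≤ d → windowCount p t L ≤ windowCount p 0 L
  windowCount-short t zero    _   = z≤n
  windowCount-short t (suc L) L<d with T? (p L)
  ... | yes pL = begin
    windowCount p t (suc L) ≤⟨ ∑-𝟙-≤ (suc L) (λ j → p (t + j)) ⟩
    suc L                   ≡⟨ ∑-𝟙-all (suc L) p (λ j j≤L → downward (≤-pred j≤L) L<d pL) ⟨
    windowCount p 0 (suc L) ∎
    where open ≤-Reasoning
  -- p fails from L on to the end of the period, so the window from 0 already holds a whole period.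
  ... | no ¬pL = begin
    windowCount p t (suc L)             ≤⟨ ∑-≤-extend (suc L) (d ∸ suc L) (λ j → 𝟙 (p (t + j))) ⟩
    windowCount p t (suc L + (d ∸ suc L)) ≡⟨ cong (windowCount p t) (m+[n∸m]≡n L<d) ⟩
    windowCount p t d                   ≡⟨ windowCount-period t ⟩
    windowCount p 0 d                   ≡⟨ cong (windowCount p 0) (m+[n∸m]≡n (<⇒≤ L<d)) ⟨
    windowCount p 0 (L + (d ∸ L))       ≡⟨ ∑-split L (d ∸ L) (𝟙 ∘ p) ⟩
    windowCount p 0 L + ∑[ j < d ∸ L ] 𝟙 (p (L + j))
      ≡⟨ cong (windowCount p 0 L +_) (∑-𝟙-none (d ∸ L) (λ j → p (L + j)) beyondL) ⟩
    windowCount p 0 L + 0               ≡⟨ +-identityʳ _ ⟩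
    windowCount p 0 L                   ≤⟨ ∑-≤-extend L 1 (𝟙 ∘ p) ⟩
    windowCount p 0 (L + 1)             ≡⟨ cong (windowCount p 0) (+-comm L 1) ⟩
    windowCount p 0 (suc L)             ∎
    where
    open ≤-Reasoning
    beyondL : ∀ j → j < d ∸ L → ¬ T (p (L + j))
    beyondL j j<d∸L pLj =
      ¬pL (downward (m≤m+n L j) (subst (L + j <_) (m+[n∸m]≡n (<⇒≤ L<d)) (+-monoʳ-< L j<d∸L)) pLj)

  windowCount-periods : ∀ t q ρ → ρ ≤ d → windowCount p t (q * d + ρ) ≤ windowCount p 0 (q * d + ρ)
  windowCount-periods t zero    ρ ρ≤d = windowCount-short t ρ ρ≤d
  windowCount-periods t (suc q) ρ ρ≤d = begin
    windowCount p t (d + q * d + ρ)                     ≡⟨ cong (windowCount p t) (+-assoc d (q * d) ρ) ⟩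
    windowCount p t (d + (q * d + ρ))                   ≡⟨ windowCount-+period t (q * d + ρ) ⟩
    windowCount p 0 d + windowCount p t (q * d + ρ)     ≤⟨ +-monoʳ-≤ _ (windowCount-periods t q ρ ρ≤d) ⟩
    windowCount p 0 d + windowCount p 0 (q * d + ρ)     ≡⟨ windowCount-+period 0 (q * d + ρ) ⟨
    windowCount p 0 (d + (q * d + ρ))                   ≡⟨ cong (windowCount p 0) (+-assoc d (q * d) ρ) ⟨
    windowCount p 0 (d + q * d + ρ)                     ∎
    where open ≤-Reasoning

  windowCount-maximal-at-0 : ∀ t L → windowCount p t L ≤ windowCount p 0 L
  windowCount-maximal-at-0 t L = subst (λ M → windowCount p t M ≤ windowCount p 0 M) L≡q*d+ρ
    (windowCount-periods t (L / d) (L % d) (<⇒≤ (m%n<n L d)))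
    where
    L≡q*d+ρ : L / d * d + L % d ≡ L
    L≡q*d+ρ = trans (+-comm _ (L % d)) (sym (m≡m%n+[m/n]*n L d))

[m%n+o]%n≡[m+o]%n : ∀ m o n .{{_ : NonZero n}} → (m % n + o) % n ≡ (m + o) % n
[m%n+o]%n≡[m+o]%n m o n = begin
  (m % n + o) % n          ≡⟨ %-distribˡ-+ (m % n) o n ⟩
  (m % n % n + o % n) % n  ≡⟨ cong (λ x → (x + o % n) % n) (m%n%n≡m%n m n) ⟩
  (m % n + o % n) % n      ≡⟨ %-distribˡ-+ m o n ⟨
  (m + o) % n              ∎
  where open ≡-Reasoning

+-%-congʳ : ∀ {x y} o n .{{_ : NonZero n}} → x % n ≡ y % n → (x + o) % n ≡ (y + o) % n
+-%-congʳ {x} {y} o n eq = begin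
  (x + o) % n      ≡⟨ [m%n+o]%n≡[m+o]%n x o n ⟨
  (x % n + o) % n  ≡⟨ cong (λ z → (z + o) % n) eq ⟩
  (y % n + o) % n  ≡⟨ [m%n+o]%n≡[m+o]%n y o n ⟩
  (y + o) % n      ∎
  where open ≡-Reasoning

[m+o]%n≡m%n⇒o≡0 : ∀ m o n .{{_ : NonZero n}} → o < n → (m + o) % n ≡ m % n → o ≡ 0
[m+o]%n≡m%n⇒o≡0 m o n o<n eq = short (m % n) (m%n<n m n) (trans ([m%n+o]%n≡[m+o]%n m o n) eq)
  where
  short : ∀ u → u < n → (u + o) % n ≡ u → o ≡ 0
  short u u<n eq with u + o <? n
  ... | yes u+o<n = +-cancelˡ-≡ u o 0 (trans (trans (sym (m<n⇒m%n≡m u+o<n)) eq) (sym (+-identityʳ u)))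
  ... | no  u+o≮n = ⊥-elim (<⇒≢ o<n (sym (+-cancelˡ-≡ u n o u+n≡u+o)))
    where
    k = u + o ∸ n
    k+n≡u+o : k + n ≡ u + o
    k+n≡u+o = m∸n+n≡m (≮⇒≥ u+o≮n)
    k<n : k < n
    k<n = m<n+o⇒m∸n<o (u + o) n (+-mono-< u<n o<n)
    k≡u : k ≡ u
    k≡u = begin
      k               ≡⟨ m<n⇒m%n≡m k<n ⟨
      k % n           ≡⟨ [m+n]%n≡m%n k n ⟨
      (k + n) % n     ≡⟨ cong (_% n) k+n≡u+o ⟩
      (u + o) % n     ≡⟨ eq ⟩
      u               ∎
      where open ≡-Reasoning
    u+n≡u+o : u + n ≡ u + o
    u+n≡u+o = trans (cong (_+ n) (sym k≡u)) k+n≡u+o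

+-%-cancel-≤ : ∀ c {u w} n .{{_ : NonZero n}} → u ≤ w → w < n → (c + w) % n ≡ (c + u) % n → w ≡ u
+-%-cancel-≤ c {u} {w} n u≤w w<n eq = begin
  w            ≡⟨ m+[n∸m]≡n u≤w ⟨
  u + (w ∸ u)  ≡⟨ cong (u +_) w∸u≡0 ⟩
  u + 0        ≡⟨ +-identityʳ u ⟩
  u            ∎
  where
  open ≡-Reasoning
  w∸u≡0 : w ∸ u ≡ 0
  w∸u≡0 = [m+o]%n≡m%n⇒o≡0 (c + u) (w ∸ u) n (≤-<-trans (m∸n≤m w u) w<n)
    (trans (cong (_% n) (trans (+-assoc c u (w ∸ u)) (cong (c +_) (m+[n∸m]≡n u≤w)))) eq)

+-%-cancelˡ : ∀ c {u w} n .{{_ : NonZero n}} → u < n → w < n → (c + u) % n ≡ (c + w) % n → u ≡ w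
+-%-cancelˡ c {u} {w} n u<n w<n eq with ≤-total u w
... | inj₁ u≤w = sym (+-%-cancel-≤ c n u≤w w<n (sym eq))
... | inj₂ w≤u = +-%-cancel-≤ c n w≤u u<n eq

T-injective : ∀ {x y} → T x ⇔ T y → x ≡ y
T-injective {false} {false} _   = refl
T-injective {false} {true}  x⇔y = ⊥-elim (Equivalence.from x⇔y _)
T-injective {true}  {false} x⇔y = ⊥-elim (Equivalence.to x⇔y _)
T-injective {true}  {true}  _   = refl

T-not-≡ᵇ : ∀ {x y} → x ≢ y → T (not (x ≡ᵇ y))
T-not-≡ᵇ {x} {y} x≢y with x ≡ᵇ y | ≡ᵇ⇒≡ x y
... | false | _    = _
... | true  | x≡y  = x≢y (x≡y _)

module Cliques (d′ n′ : ℕ) (d∣n : suc d′ ∣ suc n′) where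
  private
    d n r m : ℕ
    d = suc d′
    n = suc n′
    r = suc (suc d)
    m = n / d

    instance
      m-nonZero : NonZero m
      m-nonZero = >-nonZero (m≥n⇒m/n>0 (∣⇒≤ d∣n))

  gapFits : ℕ → ℕ → Bool
  gapFits G a = a % d + G ≤ᵇ suc d

  inClique⁺ : ∀ i x j → j < r → (i * d + j) % n ≡ x → T (inClique r n i x)
  inClique⁺ i x j j<r eq = any⁺ (λ j → (i * d + j) % n ≡ᵇ x) (applyUpTo⁺ id (≡⇒≡ᵇ _ _ eq) j<r)

  inClique⁻ : ∀ i x → T (inClique r n i x) → ∃ λ j → j < r × (i * d + j) % n ≡ x
  inClique⁻ i x x∈i with applyUpTo⁻ id (any⁻ (λ j → (i * d + j) % n ≡ᵇ x) (upTo r) x∈i)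
  ... | j , j<r , eqᵇ = j , j<r , ≡ᵇ⇒≡ _ _ eqᵇ

  adj⁺ : ∀ {x y} i → x ≢ y → i < m → T (inClique r n i x) → T (inClique r n i y) → T (adj r n x y)
  adj⁺ {x} {y} i x≢y i<m x∈i y∈i =
    Equivalence.from T-∧ (T-not-≡ᵇ x≢y , any⁺ (λ i → inClique r n i x ∧ inClique r n i y)
                                               (applyUpTo⁺ id (Equivalence.from T-∧ (x∈i , y∈i)) i<m))

  adj⁻ : ∀ {x y} → T (adj r n x y) → ∃ λ i → T (inClique r n i x) × T (inClique r n i y)
  adj⁻ {x} {y} x~y
    with applyUpTo⁻ id (any⁻ (λ i → inClique r n i x ∧ inClique r n i y) (upTo m)
                             (proj₂ (Equivalence.to T-∧ x~y)))
  ... | i , _ , both = i , Equivalence.to T-∧ both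

  private
    [i%m]*d+j≡i*d+j : ∀ i j → ((i % m) * d + j) % n ≡ (i * d + j) % n
    [i%m]*d+j≡i*d+j i j = begin
      ((i % m) * d + j) % n        ≡⟨ cong (λ x → (x + j) % n) (m%n*o≡m*o%[n*o] i m d) ⟩
      ((i * d) % (m * d) + j) % n  ≡⟨ cong (λ x → (x + j) % n) (%-congʳ (m/n*n≡m d∣n)) ⟩
      ((i * d) % n + j) % n        ≡⟨ [m%n+o]%n≡[m+o]%n (i * d) j n ⟩
      (i * d + j) % n              ∎
      where
      open ≡-Reasoning
      instance
        md-nonZero : NonZero (m * d)
        md-nonZero = m*n≢0 m d

  adj-gap⁺ : ∀ a G → 0 < G → G + r ≤ n → T (gapFits G a) → T (adj r n (a % n) ((a + G) % n))
  adj-gap⁺ a G 0<G G+r≤n fits = adj⁺ ((a / d) % m) a≢a+G (m%n<n (a / d) m) a∈i a+G∈i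
    where
    a≡q*d+ρ : a / d * d + a % d ≡ a
    a≡q*d+ρ = trans (+-comm _ (a % d)) (sym (m≡m%n+[m/n]*n a d))
    a≢a+G : a % n ≢ (a + G) % n
    a≢a+G eq = <⇒≢ 0<G (+-%-cancelˡ a n z<s (<-≤-trans (m<m+n G z<s) G+r≤n)
                         (trans (cong (_% n) (+-identityʳ a)) eq))
    a∈i : T (inClique r n ((a / d) % m) (a % n))
    a∈i = inClique⁺ ((a / d) % m) (a % n) (a % d) (m<n⇒m<1+n (m<n⇒m<1+n (m%n<n a d)))
            (trans ([i%m]*d+j≡i*d+j (a / d) (a % d)) (cong (_% n) a≡q*d+ρ))
    a+G∈i : T (inClique r n ((a / d) % m) ((a + G) % n))
    a+G∈i = inClique⁺ ((a / d) % m) ((a + G) % n) (a % d + G) (s≤s (≤ᵇ⇒≤ _ _ fits))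
              (trans ([i%m]*d+j≡i*d+j (a / d) (a % d + G))
                     (cong (_% n) (trans (sym (+-assoc _ (a % d) G)) (cong (_+ G) a≡q*d+ρ))))

  [i*d+j]%n≡x%n⇒x%d≡j%d : ∀ i j x → (i * d + j) % n ≡ x % n → x % d ≡ j % d
  [i*d+j]%n≡x%n⇒x%d≡j%d i j x eq = begin
    x % d               ≡⟨ m∣n⇒o%n%m≡o%m d n x d∣n ⟨
    x % n % d           ≡⟨ cong (_% d) eq ⟨
    (i * d + j) % n % d ≡⟨ m∣n⇒o%n%m≡o%m d n (i * d + j) d∣n ⟩
    (i * d + j) % d     ≡⟨ cong (_% d) (+-comm (i * d) j) ⟩
    (j + i * d) % d     ≡⟨ [m+kn]%n≡m%n j i d ⟩
    j % d               ∎
    where open ≡-Reasoning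

  adj-gap⁻ : ∀ a G → G + r ≤ n → T (adj r n (a % n) ((a + G) % n)) → T (gapFits G a)
  adj-gap⁻ a G G+r≤n a~a+G with adj⁻ a~a+G
  ... | i , a∈i , a+G∈i with inClique⁻ i _ a∈i | inClique⁻ i _ a+G∈i
  ... | j₁ , j₁<r , c+j₁≡a | j₂ , j₂<r , c+j₂≡a+G = ≤⇒≤ᵇ (begin
    a % d + G   ≡⟨ cong (_+ G) ([i*d+j]%n≡x%n⇒x%d≡j%d i j₁ a c+j₁≡a) ⟩
    j₁ % d + G  ≤⟨ +-monoˡ-≤ G (m%n≤m j₁ d) ⟩
    j₁ + G      ≡⟨ j₁+G≡j₂ ⟩
    j₂          ≤⟨ ≤-pred j₂<r ⟩
    suc d       ∎)
    where
    open ≤-Reasoning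
    j₁+G≡j₂ : j₁ + G ≡ j₂
    j₁+G≡j₂ = +-%-cancelˡ (i * d) n
      (<-≤-trans (subst (j₁ + G <_) (+-comm r G) (+-monoˡ-< G j₁<r)) G+r≤n)
      (<-≤-trans j₂<r (≤-trans (m≤n+m r G) G+r≤n))
      (trans (cong (_% n) (sym (+-assoc (i * d) j₁ G))) (trans (+-%-congʳ {i * d + j₁} {a} G n c+j₁≡a) (sym c+j₂≡a+G)))

  adj≡gapFits : ∀ a G → 0 < G → G + r ≤ n → adj r n (a % n) ((a + G) % n) ≡ gapFits G a
  adj≡gapFits a G 0<G G+r≤n = T-injective (mk⇔ (adj-gap⁻ a G G+r≤n) (adj-gap⁺ a G 0<G G+r≤n))

  segEdges-by-gap : ∀ t v → (∀ G → 0 < G → G < v → G + r ≤ n) →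
    segEdges r n t v ≡ ∑[ h < v ] windowCount (gapFits (suc h)) t (v ∸ suc h)
  segEdges-by-gap t v gaps≤ = begin
    segEdges r n t v
      ≡⟨ length-filterᵇ-pairsBelow _ v ⟩
    ∑[ k < v ] ∑[ j < k ] 𝟙 (adj r n ((t + j) % n) ((t + k) % n))
      ≡⟨ ∑-cong v (λ k k<v → ∑-cong k (λ j j<k → cong 𝟙 (adj-at-gap k<v j<k))) ⟩
    ∑[ k < v ] ∑[ j < k ] 𝟙 (gapFits (k ∸ j) (t + j))
      ≡⟨ ∑-triangle-by-gap v (λ j G → 𝟙 (gapFits G (t + j))) ⟩
    ∑[ h < v ] windowCount (gapFits (suc h)) t (v ∸ suc h) ∎
    where
    open ≡-Reasoning
    adj-at-gap : ∀ {k j} → k < v → j < k → adj r n ((t + j) % n) ((t + k) % n) ≡ gapFits (k ∸ j) (t + j)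
    adj-at-gap {k} {j} k<v j<k =
      trans (cong (λ x → adj r n ((t + j) % n) (x % n)) t+k≡t+j+[k∸j])
            (adj≡gapFits (t + j) (k ∸ j) 0<k∸j (gaps≤ (k ∸ j) 0<k∸j (≤-<-trans (m∸n≤m k j) k<v)))
      where
      0<k∸j : 0 < k ∸ j
      0<k∸j = m<n⇒0<n∸m j<k
      t+k≡t+j+[k∸j] : t + k ≡ t + j + (k ∸ j)
      t+k≡t+j+[k∸j] = trans (cong (t +_) (sym (m+[n∸m]≡n (<⇒≤ j<k)))) (sym (+-assoc t j (k ∸ j)))

  segEdges-maximal-at-0 : ∀ t v → (∀ G → 0 < G → G < v → G + r ≤ n) → segEdges r n t v ≤ segEdges r n 0 v
  segEdges-maximal-at-0 t v gaps≤ =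
    subst₂ _≤_ (sym (segEdges-by-gap t v gaps≤)) (sym (segEdges-by-gap 0 v gaps≤))
      (∑-mono-≤ v (λ h _ → PeriodicDownset.windowCount-maximal-at-0 d (gapFits (suc h))
                             (periodic (suc h)) (downward (suc h)) t (v ∸ suc h)))
    where
    periodic : ∀ G x → gapFits G (x + d) ≡ gapFits G x
    periodic G x = cong (λ y → y + G ≤ᵇ suc d) ([m+n]%n≡m%n x d)
    downward : ∀ G {x y} → x ≤ y → y < d → T (gapFits G y) → T (gapFits G x)
    downward G {x} {y} x≤y y<d fits = ≤⇒≤ᵇ (≤-trans (+-monoˡ-≤ G x%d≤y%d) (≤ᵇ⇒≤ _ _ fits))
      where
      x%d≤y%d : x % d ≤ y % d
      x%d≤y%d = subst₂ _≤_ (sym (m<n⇒m%n≡m (≤-<-trans x≤y y<d))) (sym (m<n⇒m%n≡m y<d)) x≤y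

gap+r≤n : ∀ {G r n} → 0 < G → G ≤ n / (2 * suc r) → G + suc r ≤ n
gap+r≤n {G} {r} {n} 0<G G≤n/2r = begin
  G + suc r                         ≤⟨ +-mono-≤ (m≤m*n G (suc r)) (m≤n*m (suc r) G {{>-nonZero 0<G}}) ⟩
  G * suc r + G * suc r             ≡⟨ cong (λ x → G * suc r + G * x) (+-identityʳ (suc r)) ⟨
  G * suc r + G * (suc r + 0)       ≡⟨ *-distribˡ-+ G (suc r) (suc r + 0) ⟨
  G * (2 * suc r)                   ≤⟨ *-monoˡ-≤ (2 * suc r) G≤n/2r ⟩
  n / (2 * suc r) * (2 * suc r)     ≤⟨ m/n*n≤m n (2 * suc r) ⟩
  n                                 ∎
  where open ≤-Reasoning

lemma3p9 : (r n v : ℕ) → 4 ≤ r → (r ∸ 2) ∣ n → r ≤ v → v ≤ n div (2 * r) + 1 →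
    Σ ℕ (λ s → s < n
      × ((∃ λ i → i < numCliques r n × s ≡ firstVertex r n i)
         ⊎ (∃ λ i → i < numCliques r n × (s + (v ∸ 1)) mod n ≡ lastVertex r n i))
      × ((t : ℕ) → t < n → segEdges r n t v ≤ segEdges r n s v))
lemma3p9 (suc (suc (suc (suc r′)))) zero v (s≤s (s≤s (s≤s (s≤s _)))) _ r≤v v≤1
  with s≤s () ← ≤-trans r≤v v≤1
lemma3p9 r@(suc (suc (suc (suc r′)))) (suc n′) v (s≤s (s≤s (s≤s (s≤s _)))) d∣n r≤v v≤q+1 =
  0 , z<s , inj₁ (0 , m≥n⇒m/n>0 (∣⇒≤ d∣n) , refl) ,
  λ t _ → Cliques.segEdges-maximal-at-0 (suc r′) n′ d∣n t v gaps≤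
  where
  gaps≤ : ∀ G → 0 < G → G < v → G + r ≤ suc n′
  gaps≤ G 0<G G<v = gap+r≤n 0<G (≤-pred (subst (suc G ≤_) (+-comm (suc n′ / (2 * r)) 1) (<-≤-trans G<v v≤q+1)))
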